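{- Fix a positive integer $k$. Let $\mathbf i_k$ be the concatenation of the sequences $R_1,R_2,\dots,R_{2k-1}$, where for $1\le r\le k$, $R_r=(k-r+1,\ k-r+3,\ k-r+5,\ \dots,\ k+r-1)$ (the $r$ integers from $k-r+1$ to $k+r-1$ in steps of $2$), and for $k<r\le 2k-1$, $R_r=R_{2k-r}$; this is a reduced word for a permutation in $S_{2k}$. Let $C=C(\mathbf i_k)$. Then the uniform vote tally $\rho=\mathbb 1_{\operatorname{Pre}(C)}$ has majority relation $\triangleleft_\rho$ equal to the prelinear order on $[2k]$ with ordered set partition $(\{1,k+1\},\{2,k+2\},\{3,k+3\},\dots,\{k,2k\})$.
   Context: For $w=(w_1,\dots,w_n)\in S_n$, $<_w$ denotes the linear order $w_1<_w\cdots<_w w_n$ on $[n]$, and $\operatorname{Inv}(w)=\{(a,b):1\le a<b\le n,\ b<_w a\}$. Let $s_i$ be the adjacent transposition of $i,i+1$; $ws_i$ is obtained from $w$ by swapping the entries in positions $i,i+1$. A reduced word for $w$ is $(i_1,\dots,i_\ell)$ with $w=s_{i_1}\cdots s_{i_\ell}$, $\ell=|\operatorname{Inv}(w)|$. The commutation class $C(\mathbf i)$ is the set of words obtained from $\mathbf i$ by repeatedly swapping adjacent entries differing by at least $2$. $\operatorname{Pre}(C)$ is the set of all $s_{i'_1}\cdots s_{i'_m}$ with $(i'_1,\dots,i'_m)$ a prefix of a word in $C$. The uniform vote tally $\mathbb 1_{\operatorname{Pre}(C)}$ is $1$ on $\operatorname{Pre}(C)$ and $0$ elsewhere. For a vote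 tally $\rho:S_n\to\mathbb N$, the majority relation is $a\triangleleft_\rho b$ iff $\sum_{w':\,a<_{w'}b}\rho(w')>\sum_{w':\,b<_{w'}a}\rho(w')$. A prelinear order with ordered set partition $(B_1,\dots,B_m)$ of $[n]$ is the relation $a\prec b$ iff $a\in B_r$, $b\in B_s$ with $r<s$. -}

module Defs where

open import Data.Bool using (true; false)
open import Data.Nat using (_≤ᵇ_; ℕ; zero; suc; _+_; _*_; _∸_; _≤_; _<_)
open import Data.List using (List; []; _∷_; _++_; map; foldl; take; concatMap; upTo; length)
open import Data.List.Membership.Propositional using (_∈_)
open import Data.List.Relation.Unary.Unique.Propositional using (Unique)
open import Data.List.Relation.Binary.Permutation.Propositional using (_↭_)
open import Data.Product using (Σ; ∃; ∃-syntax; _×_; _,_)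
open import Data.Sum using (_⊎_)
open import Function.Bundles using (_⇔_)
open import Relation.Binary.PropositionalEquality using (_≡_)
open import Relation.Binary.Construct.Closure.ReflexiveTransitive using (Star)

-- Permutations of [n] = {1,…,n} in one-line notation (w₁,…,wₙ), as lists.
idPerm : ℕ → List ℕ
idPerm n = map suc (upTo n)

IsPerm : ℕ → List ℕ → Set
IsPerm n w = w ↭ idPerm n

-- w ↦ w sᵢ : swap the entries in positions i, i+1 (positions 1-indexed)
swapAt : ℕ → List ℕ → List ℕ
swapAt (suc zero) (x ∷ y ∷ r) = y ∷ x ∷ r
swapAt (suc (suc i)) (x ∷ r) = x ∷ swapAt (suc i) r
swapAt _ w = w

-- s_{i₁} ⋯ s_{iₘ} ∈ S_n  (= ((e s_{i₁}) s_{i₂}) ⋯ s_{iₘ})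
evalWord : ℕ → List ℕ → List ℕ
evalWord n ws = foldl (λ w i → swapAt i w) (idPerm n) ws

Before : List ℕ → ℕ → ℕ → Set
Before w a b = ∃[ xs ] ∃[ ys ] ∃[ zs ] (w ≡ xs ++ (a ∷ ys ++ (b ∷ zs)))

data CommStep : List ℕ → List ℕ → Set where
  comm : ∀ u v a b → (a + 2 ≤ b ⊎ b + 2 ≤ a) →
         CommStep (u ++ (a ∷ b ∷ v)) (u ++ (b ∷ a ∷ v))

InCommClass : List ℕ → List ℕ → Set
InCommClass i u = Star CommStep i u

InPre : ℕ → List ℕ → List ℕ → Set
InPre n i w = ∃[ u ] ∃[ m ] (InCommClass i u × w ≡ evalWord n (take m u))

HasCard : (List ℕ → Set) → ℕ → Set
HasCard P N = ∃[ L ] (Unique L × (∀ w → (w ∈ L ⇔ P w)) × length L ≡ N)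

-- For the uniform vote tally ρ = 𝟙_S (S ⊆ S_n):
--   Σ_{w' ∈ S_n, a <_{w'} b} ρ(w') = #{ w' ∈ S_n : w' ∈ S, a <_{w'} b }.
-- Majority relation a ◁_ρ b.
UniformMajority : ℕ → (List ℕ → Set) → ℕ → ℕ → Set
UniformMajority n S a b =
  ∃[ N ] ∃[ M ]
    ( HasCard (λ w → IsPerm n w × S w × Before w a b) N
    × HasCard (λ w → IsPerm n w × S w × Before w b a) M
    × M < N )

rowUp : ℕ → ℕ → List ℕ
rowUp k r = map (λ j → (k ∸ r) + 1 + 2 * j) (upTo r)

row : ℕ → ℕ → List ℕ
row k r with r ≤ᵇ k
... | true  = rowUp k r
... | false = rowUp k (2 * k ∸ r)

wordI : ℕ → List ℕ
wordI k = concatMap (row k) (map suc (upTo (2 * k ∸ 1)))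

block : ℕ → ℕ → ℕ
block k a with a ≤ᵇ k
... | true  = a
... | false = a ∸ k

PrelinOrder : ℕ → ℕ → ℕ → Set
PrelinOrder k a b = block k a < block k b

-- Record a shuffle of (1,…,k) with (k+1,…,2k) by its bit string (true at the small entries).  A
-- letter moving a small entry past a large one acts on bit strings by swapping a pair true, false,
-- and row by row the word i_k runs in this way from 1ᵏ0ᵏ to 0ᵏ1ᵏ, so every prefix of a word in
-- C(i_k) yields a shuffle.  Conversely 0ᵏ1ᵏ admits no such swap, so a swap available after a prefix
-- is performed later in the word by a letter that commutes forward; hence Pre(C(i_k)) is exactly
-- the set of shuffles.  Exchanging i with k+i (flipping all bits) is an involution of the shuffles.
-- If block a < block c, it maps the shuffles ranking c before a injectively into those ranking a
-- before c, missing the shuffle (1,…,t, k+1,…,2k, t+1,…,k) with t = block a; if the blocks agree,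
-- it maps either side into the other.

module Submission where

open import Defs

open import Data.Bool using (Bool; true; false; not; if_then_else_)
open import Data.Bool.Properties using (not-involutive; T-≡; ¬-not)
open import Data.Empty using (⊥; ⊥-elim)
open import Data.List
  using (List; []; _∷_; _++_; [_]; foldl; take; filter; length; map; replicate; iterate; applyUpTo; upTo; concatMap)
open import Data.List.Properties
  using ( ++-assoc; length-++; length-++-sucʳ; length-replicate; length-map; length-iterate; map-upTo; map-++
        ; map-id; map-∘; map-cong; map-cong-local; take++drop≡id; ∷-injective; ∷-injectiveˡ; ∷-injectiveʳ)
open import Data.List.Membership.Propositional using (_∈_)
open import Data.List.Membership.Propositional.Properties
  using (∈-∃++; ∈-++⁺ˡ; ∈-++⁺ʳ; ∈-++⁻; ∈-map⁺; ∈-map⁻; ∈-filter⁺; ∈-filter⁻)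
open import Data.List.Relation.Binary.Disjoint.Propositional using (Disjoint)
open import Data.List.Relation.Binary.Permutation.Propositional
  using (_↭_; prep; ↭-refl; ↭-trans; ↭-sym; ↭-reflexive; ↭⇒↭ₛ)
open import Data.List.Relation.Binary.Permutation.Propositional.Properties using (shift)
import Data.List.Relation.Binary.Permutation.Setoid.Properties as Permutationₛ
open import Data.List.Relation.Unary.All using (All; []; _∷_)
import Data.List.Relation.Unary.All as All
import Data.List.Relation.Unary.All.Properties as All
open import Data.List.Relation.Unary.Any using (here; there)
open import Data.List.Relation.Unary.Unique.Propositional using (Unique; []; _∷_)
import Data.List.Relation.Unary.Unique.Propositional.Properties as Unique
open import Data.List.Relation.Unary.Unique.Propositional.Properties using (Unique[x∷xs]⇒x∉xs)
open import Data.Nat using (ℕ; zero; suc; _+_; _*_; _∸_; _≤_; _<_; _≤ᵇ_; s≤s; z≤n)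
open import Data.Nat.Properties
open import Data.Nat.Tactic.RingSolver using (solve-∀)
open import Data.List.Membership.DecPropositional _≟_ using (_∈?_)
open import Data.Product using (∃-syntax; _×_; _,_)
open import Data.Sum using (_⊎_; inj₁; inj₂)
import Data.Sum as Sum
open import Data.Unit using (⊤; tt)
open import Function using (_∘_; id)
open import Function.Bundles using (_⇔_; mk⇔; Equivalence)
open import Relation.Binary.Construct.Closure.ReflexiveTransitive using (ε; _◅_; _◅◅_)
open import Relation.Binary.Definitions using (tri<; tri≈; tri>)
open import Relation.Binary.PropositionalEquality
  using (_≡_; _≢_; refl; sym; trans; cong; cong₂; subst; subst₂; setoid; module ≡-Reasoning)
open import Relation.Nullary using (¬_; Dec; yes; no)
open import Relation.Nullary.Decidable using (_×-dec_)

-- Lists and cardinalities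

replicate-++-∷ : ∀ {A : Set} n (x : A) Z → replicate n x ++ x ∷ Z ≡ x ∷ replicate n x ++ Z
replicate-++-∷ zero    x Z = refl
replicate-++-∷ (suc n) x Z = cong (x ∷_) (replicate-++-∷ n x Z)

take-length-++ : ∀ {A : Set} (p s : List A) → take (length p) (p ++ s) ≡ p
take-length-++ []      s = refl
take-length-++ (x ∷ p) s = cong (x ∷_) (take-length-++ p s)

<-split : ∀ {m n} → m < n → ∃[ d ] n ≡ m + suc d
<-split {m} {n} m<n = n ∸ suc m , sym (trans (+-suc m (n ∸ suc m)) (m+[n∸m]≡n m<n))

k+t≤2k⇒t≤k : ∀ k t → k + t ≤ 2 * k → t ≤ k
k+t≤2k⇒t≤k k t k+t≤2k = +-cancelˡ-≤ k t k (subst (k + t ≤_) (cong (k +_) (+-identityʳ k)) k+t≤2k)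

≤ᵇ≡true : ∀ {m n} → m ≤ n → (m ≤ᵇ n) ≡ true
≤ᵇ≡true = Equivalence.to T-≡ ∘ ≤⇒≤ᵇ

≤ᵇ≡false : ∀ {m n} → n < m → (m ≤ᵇ n) ≡ false
≤ᵇ≡false {m} {n} n<m = ¬-not (λ m≤ᵇn → <⇒≱ n<m (≤ᵇ⇒≤ m n (Equivalence.from T-≡ m≤ᵇn)))

map-not-involutive : ∀ b → map not (map not b) ≡ b
map-not-involutive b = trans (sym (map-∘ b)) (trans (map-cong not-involutive b) (map-id b))

All-iterate-suc : ∀ {P : ℕ → Set} s n → (∀ r → s ≤ r → r < s + n → P r) → All P (iterate suc s n)
All-iterate-suc s zero    _ = []
All-iterate-suc s (suc n) h =
  h s ≤-refl (m<m+n s (s≤s z≤n)) ∷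
  All-iterate-suc (suc s) n (λ r s<r r<s+n → h r (<⇒≤ s<r) (subst (r <_) (sym (+-suc s n)) r<s+n))

applyUpTo-iterate-suc : ∀ (f : ℕ → ℕ) s n → (∀ i → f i ≡ s + i) → applyUpTo f n ≡ iterate suc s n
applyUpTo-iterate-suc f s zero    _ = refl
applyUpTo-iterate-suc f s (suc n) h =
  cong₂ _∷_ (trans (h 0) (+-identityʳ s))
            (applyUpTo-iterate-suc (λ i → f (suc i)) (suc s) n (λ i → trans (h (suc i)) (+-suc s i)))

map-suc-upTo : ∀ n → map suc (upTo n) ≡ iterate suc 1 n
map-suc-upTo n = trans (map-upTo suc n) (applyUpTo-iterate-suc suc 1 n (λ _ → refl))

iterate-suc-++ : ∀ s m n → iterate suc s (m + n) ≡ iterate suc s m ++ iterate suc (s + m) n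
iterate-suc-++ s zero    n = cong (λ e → iterate suc e n) (sym (+-identityʳ s))
iterate-suc-++ s (suc m) n =
  cong (s ∷_) (trans (iterate-suc-++ (suc s) m n) (cong (λ e → iterate suc (suc s) m ++ iterate suc e n) (sym (+-suc s m))))

map-+-iterate-suc : ∀ m s n → map (m +_) (iterate suc s n) ≡ iterate suc (m + s) n
map-+-iterate-suc m s zero    = refl
map-+-iterate-suc m s (suc n) =
  cong (m + s ∷_) (trans (map-+-iterate-suc m (suc s) n) (cong (λ e → iterate suc e n) (+-suc m s)))

∈-iterate-suc : ∀ s n {y} → s ≤ y → y < s + n → y ∈ iterate suc s n
∈-iterate-suc s zero    s≤y y<s+0 = ⊥-elim (<⇒≱ y<s+0 (subst (_≤ _) (sym (+-identityʳ s)) s≤y))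
∈-iterate-suc s (suc n) {y} s≤y y<s+n with m≤n⇒m<n∨m≡n s≤y
... | inj₂ refl = here refl
... | inj₁ s<y  = there (∈-iterate-suc (suc s) n s<y (subst (y <_) (+-suc s n) y<s+n))

Before-∷⁻ : ∀ {h w x y} → Before (h ∷ w) x y → (h ≡ x × y ∈ w) ⊎ Before w x y
Before-∷⁻ ([] , ys , zs , eq) with ∷-injective eq
... | refl , refl = inj₁ (refl , ∈-++⁺ʳ ys (here refl))
Before-∷⁻ (_ ∷ xs , ys , zs , eq) with ∷-injective eq
... | refl , eq′ = inj₂ (xs , ys , zs , eq′)

Before-∷ : ∀ {h w x y} → Before w x y → Before (h ∷ w) x y
Before-∷ (xs , ys , zs , eq) = _ ∷ xs , ys , zs , cong (_ ∷_) eq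

Before-here : ∀ {w x y} → y ∈ w → Before (x ∷ w) x y
Before-here y∈w with ∈-∃++ y∈w
... | ys , zs , refl = [] , ys , zs , refl

¬Before-[] : ∀ {x y} → ¬ Before [] x y
¬Before-[] ([]    , _ , _ , ())
¬Before-[] (_ ∷ _ , _ , _ , ())

Before? : ∀ w x y → Dec (Before w x y)
Before? []      x y = no ¬Before-[]
Before? (h ∷ w) x y with (h ≟ x) ×-dec (y ∈? w) | Before? w x y
... | yes (refl , y∈w) | _      = yes (Before-here y∈w)
... | no _             | yes b  = yes (Before-∷ b)
... | no ¬here         | no ¬b  = no λ b → Sum.[ ¬here , ¬b ] (Before-∷⁻ b)

Before⇒∈ʳ : ∀ {w x y} → Before w x y → y ∈ w
Before⇒∈ʳ (xs , ys , zs , refl) = ∈-++⁺ʳ xs (there (∈-++⁺ʳ ys (here refl)))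

Before-trans : ∀ {w x y z} → Unique w → Before w x y → Before w y z → Before w x z
Before-trans {[]} _ b _ = ⊥-elim (¬Before-[] b)
Before-trans {h ∷ w} u@(_ ∷ uw) b₁ b₂ with Before-∷⁻ b₁ | Before-∷⁻ b₂
... | inj₁ (refl , y∈w) | inj₁ (refl , _) = ⊥-elim (Unique[x∷xs]⇒x∉xs u y∈w)
... | inj₁ (refl , _)   | inj₂ b₂′        = Before-here (Before⇒∈ʳ b₂′)
... | inj₂ b₁′          | inj₁ (refl , _) = ⊥-elim (Unique[x∷xs]⇒x∉xs u (Before⇒∈ʳ b₁′))
... | inj₂ b₁′          | inj₂ b₂′        = Before-∷ (Before-trans uw b₁′ b₂′)

Before-asym : ∀ {w x y} → Unique w → Before w x y → ¬ Before w y x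
Before-asym {[]} _ b _ = ¬Before-[] b
Before-asym {h ∷ w} u@(_ ∷ uw) b₁ b₂ with Before-∷⁻ b₁ | Before-∷⁻ b₂
... | inj₁ (refl , y∈w) | inj₁ (refl , _) = Unique[x∷xs]⇒x∉xs u y∈w
... | inj₁ (refl , _)   | inj₂ b₂′        = Unique[x∷xs]⇒x∉xs u (Before⇒∈ʳ b₂′)
... | inj₂ b₁′          | inj₁ (refl , _) = Unique[x∷xs]⇒x∉xs u (Before⇒∈ʳ b₁′)
... | inj₂ b₁′          | inj₂ b₂′        = Before-asym uw b₁′ b₂′

Before-map : ∀ (f : ℕ → ℕ) {w x y} → Before w x y → Before (map f w) (f x) (f y)
Before-map f (xs , ys , zs , refl) =
  map f xs , map f ys , map f zs , trans (map-++ f xs _) (cong (λ W → map f xs ++ f _ ∷ W) (map-++ f ys _))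

Before-++ : ∀ {P Q x y} → x ∈ P → y ∈ Q → Before (P ++ Q) x y
Before-++ {x = x} x∈P y∈Q with ∈-∃++ x∈P | ∈-∃++ y∈Q
... | P₁ , P₂ , refl | Q₁ , Q₂ , refl =
  P₁ , P₂ ++ Q₁ , Q₂ , trans (++-assoc P₁ (x ∷ P₂) _) (cong (λ W → P₁ ++ x ∷ W) (sym (++-assoc P₂ Q₁ _)))

Before-++ʳ : ∀ P {Q x y} → Before Q x y → Before (P ++ Q) x y
Before-++ʳ []      b = b
Before-++ʳ (_ ∷ P) b = Before-∷ (Before-++ʳ P b)

Before-iterate-suc : ∀ s n {x y} → s ≤ x → x < y → y < s + n → Before (iterate suc s n) x y
Before-iterate-suc s zero    s≤x x<y y<s+0 =
  ⊥-elim (<⇒≱ (<-trans x<y y<s+0) (subst (_≤ _) (sym (+-identityʳ s)) s≤x))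
Before-iterate-suc s (suc n) {y = y} s≤x x<y y<s+n with m≤n⇒m<n∨m≡n s≤x
... | inj₂ refl = Before-here (∈-iterate-suc (suc s) n x<y (subst (y <_) (+-suc s n) y<s+n))
... | inj₁ s<x  = Before-∷ (Before-iterate-suc (suc s) n s<x x<y (subst (y <_) (+-suc s n) y<s+n))

length-≤-⊆ : ∀ {A : Set} (xs ys : List A) → Unique xs → (∀ {x} → x ∈ xs → x ∈ ys) → length xs ≤ length ys
length-≤-⊆ []       ys _          _   = z≤n
length-≤-⊆ (x ∷ xs) ys (x∉xs ∷ u) xs⊆ys with ∈-∃++ (xs⊆ys (here refl))
... | ys₁ , ys₂ , refl =
  subst (suc (length xs) ≤_) (sym (length-++-sucʳ ys₁ x ys₂)) (s≤s (length-≤-⊆ xs (ys₁ ++ ys₂) u xs⊆ys₁ys₂))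
  where
  xs⊆ys₁ys₂ : ∀ {z} → z ∈ xs → z ∈ ys₁ ++ ys₂
  xs⊆ys₁ys₂ z∈xs with ∈-++⁻ ys₁ (xs⊆ys (there z∈xs))
  ... | inj₁ z∈ys₁         = ∈-++⁺ˡ z∈ys₁
  ... | inj₂ (here refl)   = ⊥-elim (All.lookup x∉xs z∈xs refl)
  ... | inj₂ (there z∈ys₂) = ∈-++⁺ʳ ys₁ z∈ys₂

Unique-map : ∀ {A B : Set} (g : A → B) {xs} → Unique xs → (∀ {x y} → x ∈ xs → y ∈ xs → g x ≡ g y → x ≡ y) →
             Unique (map g xs)
Unique-map g {[]}     []          _   = []
Unique-map g {x ∷ xs} (x∉xs ∷ u) inj =
  All.map⁺ (All.tabulate (λ y∈xs eq → All.lookup x∉xs y∈xs (inj (here refl) (there y∈xs) eq))) ∷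
  Unique-map g u (λ x∈ y∈ → inj (there x∈) (there y∈))

Unique-++⇒Disjoint : ∀ xs {ys : List ℕ} → Unique (xs ++ ys) → Disjoint xs ys
Unique-++⇒Disjoint (x ∷ xs) (x∉ ∷ _) (here refl , v∈ys) = All.lookup x∉ (∈-++⁺ʳ xs v∈ys) refl
Unique-++⇒Disjoint (_ ∷ xs) (_ ∷ u)  (there v∈xs , v∈ys) = Unique-++⇒Disjoint xs u (v∈xs , v∈ys)

Unique-idPerm : ∀ n → Unique (idPerm n)
Unique-idPerm n = Unique.map⁺ suc-injective (Unique.upTo⁺ n)

IsPerm⇒Unique : ∀ {n w} → IsPerm n w → Unique w
IsPerm⇒Unique {n} w↭ = Permutationₛ.Unique-resp-↭ (setoid ℕ) (↭⇒↭ₛ (↭-sym w↭)) (Unique-idPerm n)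

Image : (List ℕ → List ℕ) → (List ℕ → Set) → List ℕ → Set
Image g P z = ∃[ w ] (P w × z ≡ g w)

HasCard-image : ∀ {P N} (g : List ℕ → List ℕ) → HasCard P N →
                (∀ {w w′} → P w → P w′ → g w ≡ g w′ → w ≡ w′) → HasCard (Image g P) N
HasCard-image {P} g (L , u , ∈L⇔ , refl) inj =
  map g L , Unique-map g u (λ w∈ w′∈ → inj (to w∈) (to w′∈)) , (λ z → mk⇔ image⁺ image⁻) , length-map g L
  where
  to : ∀ {w} → w ∈ L → P w
  to {w} = Equivalence.to (∈L⇔ w)
  image⁺ : ∀ {z} → z ∈ map g L → Image g P z
  image⁺ z∈ with ∈-map⁻ g z∈
  ... | w , w∈ , refl = w , to w∈ , refl
  image⁻ : ∀ {z} → Image g P z → z ∈ map g L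
  image⁻ (w , pw , refl) = ∈-map⁺ g (Equivalence.from (∈L⇔ w) pw)

HasCard-⊆ : ∀ {P Q N M} → HasCard P N → HasCard Q M → (∀ {w} → P w → Q w) → N ≤ M
HasCard-⊆ (L₁ , u₁ , ∈L₁⇔ , refl) (L₂ , _ , ∈L₂⇔ , refl) P⊆Q =
  length-≤-⊆ L₁ L₂ u₁ (λ {w} w∈ → Equivalence.from (∈L₂⇔ w) (P⊆Q (Equivalence.to (∈L₁⇔ w) w∈)))

HasCard-⊂ : ∀ {P Q N M} → HasCard P N → HasCard Q M → (∀ {w} → P w → Q w) → ∀ w₀ → Q w₀ → ¬ P w₀ → N < M
HasCard-⊂ (L₁ , u₁ , ∈L₁⇔ , refl) (L₂ , _ , ∈L₂⇔ , refl) P⊆Q w₀ qw₀ ¬pw₀ =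
  length-≤-⊆ (w₀ ∷ L₁) L₂ (All.tabulate w₀∉L₁ ∷ u₁) sub
  where
  w₀∉L₁ : ∀ {w} → w ∈ L₁ → w₀ ≢ w
  w₀∉L₁ {w} w∈ refl = ¬pw₀ (Equivalence.to (∈L₁⇔ w) w∈)
  sub : ∀ {w} → w ∈ w₀ ∷ L₁ → w ∈ L₂
  sub (here refl) = Equivalence.from (∈L₂⇔ w₀) qw₀
  sub {w} (there w∈) = Equivalence.from (∈L₂⇔ w) (P⊆Q (Equivalence.to (∈L₁⇔ w) w∈))

-- Bit strings and runs

-- On the bit string of a shuffle (true = small entry), a letter i that lengthens the shuffle is one
-- that finds true, false at positions i, i + 1.

swapAtᵇ : ℕ → List Bool → List Bool
swapAtᵇ (suc zero)    (x ∷ y ∷ c) = y ∷ x ∷ c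
swapAtᵇ (suc (suc i)) (x ∷ c)     = x ∷ swapAtᵇ (suc i) c
swapAtᵇ _             c           = c

TrueFalseAt : ℕ → List Bool → Set
TrueFalseAt (suc zero)    (true ∷ false ∷ _) = ⊤
TrueFalseAt (suc (suc i)) (_ ∷ c)            = TrueFalseAt (suc i) c
TrueFalseAt _             _                  = ⊥

Far : ℕ → ℕ → Set
Far a b = a + 2 ≤ b ⊎ b + 2 ≤ a

Far-sym : ∀ {a b} → Far a b → Far b a
Far-sym = Sum.swap

swapAtᵇ-involutive : ∀ i c → swapAtᵇ i (swapAtᵇ i c) ≡ c
swapAtᵇ-involutive zero          c           = refl
swapAtᵇ-involutive (suc zero)    []          = refl
swapAtᵇ-involutive (suc zero)    (x ∷ [])    = refl
swapAtᵇ-involutive (suc zero)    (x ∷ y ∷ c) = refl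
swapAtᵇ-involutive (suc (suc i)) []          = refl
swapAtᵇ-involutive (suc (suc i)) (x ∷ c)     = cong (x ∷_) (swapAtᵇ-involutive (suc i) c)

swapAtᵇ-comm-below : ∀ i j c → i + 2 ≤ j → swapAtᵇ i (swapAtᵇ j c) ≡ swapAtᵇ j (swapAtᵇ i c)
swapAtᵇ-comm-below zero          _                   c           _ = refl
swapAtᵇ-comm-below (suc zero)    (suc (suc (suc j))) []          _ = refl
swapAtᵇ-comm-below (suc zero)    (suc (suc (suc j))) (x ∷ [])    _ = refl
swapAtᵇ-comm-below (suc zero)    (suc (suc (suc j))) (x ∷ y ∷ c) _ = refl
swapAtᵇ-comm-below (suc (suc i)) (suc (suc j))       []          _ = refl
swapAtᵇ-comm-below (suc (suc i)) (suc (suc j))       (x ∷ c) (s≤s (s≤s le)) =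
  cong (x ∷_) (swapAtᵇ-comm-below (suc i) (suc j) c (s≤s le))
swapAtᵇ-comm-below (suc zero)    (suc zero)          _ (s≤s ())
swapAtᵇ-comm-below (suc zero)    (suc (suc zero))    _ (s≤s (s≤s ()))
swapAtᵇ-comm-below (suc (suc i)) (suc zero)          _ (s≤s ())

swapAtᵇ-comm : ∀ {i j} c → Far i j → swapAtᵇ i (swapAtᵇ j c) ≡ swapAtᵇ j (swapAtᵇ i c)
swapAtᵇ-comm {i} {j} c (inj₁ i+2≤j) = swapAtᵇ-comm-below i j c i+2≤j
swapAtᵇ-comm {i} {j} c (inj₂ j+2≤i) = sym (swapAtᵇ-comm-below j i c j+2≤i)

TrueFalseAt-head : ∀ x y c d → TrueFalseAt 1 (x ∷ y ∷ c) → TrueFalseAt 1 (x ∷ y ∷ d)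
TrueFalseAt-head true false _ _ t = t

TrueFalseAt-swapAtᵇ-below : ∀ i j c → i + 2 ≤ j → TrueFalseAt j (swapAtᵇ i c) → TrueFalseAt j c
TrueFalseAt-swapAtᵇ-below zero                _                   c           _ t = t
TrueFalseAt-swapAtᵇ-below (suc zero)          (suc (suc (suc j))) []          _ t = t
TrueFalseAt-swapAtᵇ-below (suc zero)          (suc (suc (suc j))) (x ∷ [])    _ t = t
TrueFalseAt-swapAtᵇ-below (suc zero)          (suc (suc (suc j))) (x ∷ y ∷ c) _ t = t
TrueFalseAt-swapAtᵇ-below (suc (suc i))       (suc (suc j))       []          _ t = t
TrueFalseAt-swapAtᵇ-below (suc (suc i))       (suc (suc j))       (x ∷ c) (s≤s (s≤s le)) t =
  TrueFalseAt-swapAtᵇ-below (suc i) (suc j) c (s≤s le) t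
TrueFalseAt-swapAtᵇ-below (suc zero)          (suc zero)          _ (s≤s ())
TrueFalseAt-swapAtᵇ-below (suc zero)          (suc (suc zero))    _ (s≤s (s≤s ()))
TrueFalseAt-swapAtᵇ-below (suc (suc i))       (suc zero)          _ (s≤s ())

TrueFalseAt-swapAtᵇ-above : ∀ i j c → j + 2 ≤ i → TrueFalseAt j (swapAtᵇ i c) → TrueFalseAt j c
TrueFalseAt-swapAtᵇ-above _                   zero          _ _ ()
TrueFalseAt-swapAtᵇ-above (suc (suc (suc i))) (suc zero)    []          _ t = t
TrueFalseAt-swapAtᵇ-above (suc (suc (suc i))) (suc zero)    (x ∷ [])    _ t = t
TrueFalseAt-swapAtᵇ-above (suc (suc (suc i))) (suc zero)    (x ∷ y ∷ c) _ t =
  TrueFalseAt-head x y (swapAtᵇ (suc i) c) c t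
TrueFalseAt-swapAtᵇ-above (suc (suc i))       (suc (suc j)) []          _ t = t
TrueFalseAt-swapAtᵇ-above (suc (suc i))       (suc (suc j)) (x ∷ c) (s≤s (s≤s le)) t =
  TrueFalseAt-swapAtᵇ-above (suc i) (suc j) c (s≤s le) t
TrueFalseAt-swapAtᵇ-above zero                (suc j)       _ ()
TrueFalseAt-swapAtᵇ-above (suc zero)          (suc zero)    _ (s≤s ())
TrueFalseAt-swapAtᵇ-above (suc zero)          (suc (suc j)) _ (s≤s ())
TrueFalseAt-swapAtᵇ-above (suc (suc zero))    (suc zero)    _ (s≤s (s≤s ()))

TrueFalseAt-swapAtᵇ⁻ : ∀ {i j} c → Far i j → TrueFalseAt j (swapAtᵇ i c) → TrueFalseAt j c
TrueFalseAt-swapAtᵇ⁻ {i} {j} c (inj₁ i+2≤j) = TrueFalseAt-swapAtᵇ-below i j c i+2≤j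
TrueFalseAt-swapAtᵇ⁻ {i} {j} c (inj₂ j+2≤i) = TrueFalseAt-swapAtᵇ-above i j c j+2≤i

TrueFalseAt-swapAtᵇ⁺ : ∀ {i j} c → Far i j → TrueFalseAt j c → TrueFalseAt j (swapAtᵇ i c)
TrueFalseAt-swapAtᵇ⁺ {i} {j} c far t =
  TrueFalseAt-swapAtᵇ⁻ (swapAtᵇ i c) far (subst (TrueFalseAt j) (sym (swapAtᵇ-involutive i c)) t)

TrueFalseAt-adjacent : ∀ i c → TrueFalseAt i c → TrueFalseAt (suc i) c → ⊥
TrueFalseAt-adjacent (suc zero)    (true ∷ false ∷ c) _ ()
TrueFalseAt-adjacent (suc (suc i)) (_ ∷ c)            t t′ = TrueFalseAt-adjacent (suc i) c t t′

TrueFalseAt-++ : ∀ X r → TrueFalseAt (suc (length X)) (X ++ true ∷ false ∷ r)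
TrueFalseAt-++ []      r = tt
TrueFalseAt-++ (x ∷ X) r = TrueFalseAt-++ X r

swapAtᵇ-++ : ∀ X a b r → swapAtᵇ (suc (length X)) (X ++ a ∷ b ∷ r) ≡ X ++ b ∷ a ∷ r
swapAtᵇ-++ []      a b r = refl
swapAtᵇ-++ (x ∷ X) a b r = cong (x ∷_) (swapAtᵇ-++ X a b r)

data Run : List Bool → List ℕ → List Bool → Set where
  []  : ∀ {c} → Run c [] c
  _∷_ : ∀ {i c u d} → TrueFalseAt i c → Run (swapAtᵇ i c) u d → Run c (i ∷ u) d

Run-cast : ∀ {c c′ u u′ d d′} → c ≡ c′ → u ≡ u′ → d ≡ d′ → Run c u d → Run c′ u′ d′
Run-cast refl refl refl r = r

Run-++ : ∀ {c p d q e} → Run c p d → Run d q e → Run c (p ++ q) e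
Run-++ []      r′ = r′
Run-++ (t ∷ r) r′ = t ∷ Run-++ r r′

Run-++⁻ : ∀ {c} p {q e} → Run c (p ++ q) e → ∃[ d ] (Run c p d × Run d q e)
Run-++⁻ []      r       = _ , [] , r
Run-++⁻ (i ∷ p) (t ∷ r) with Run-++⁻ p r
... | d , r₁ , r₂ = d , t ∷ r₁ , r₂

Run-functional : ∀ {c u d d′} → Run c u d → Run c u d′ → d ≡ d′
Run-functional []      []        = refl
Run-functional (_ ∷ r) (_ ∷ r′) = Run-functional r r′

Run-swap-far : ∀ {a b c v d} → Far a b → Run c (a ∷ b ∷ v) d → Run c (b ∷ a ∷ v) d
Run-swap-far {c = c} far (ta ∷ tb ∷ r) =
  TrueFalseAt-swapAtᵇ⁻ c far tb ∷ TrueFalseAt-swapAtᵇ⁺ c (Far-sym far) ta ∷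
  subst (λ c′ → Run c′ _ _) (sym (swapAtᵇ-comm c far)) r

Run-commStep : ∀ {c x y d} → CommStep x y → Run c x d → Run c y d
Run-commStep (comm u v a b far) r with Run-++⁻ u r
... | _ , r₁ , r₂ = Run-++ r₁ (Run-swap-far far r₂)

Run-commClass : ∀ {c x y d} → InCommClass x y → Run c x d → Run c y d
Run-commClass ε        r = r
Run-commClass (s ◅ ss) r = Run-commClass ss (Run-commStep s r)

Run-∷ : ∀ x {c u d} → Run c u d → Run (x ∷ c) (map suc u) (x ∷ d)
Run-∷ x []                 = []
Run-∷ x (_∷_ {zero}  () _)
Run-∷ x (_∷_ {suc i} t  r) = t ∷ Run-∷ x r

Run-chain : ∀ (f : ℕ → List Bool) (g : ℕ → List ℕ) s n →
            All (λ r → Run (f r) (g r) (f (suc r))) (iterate suc s n) →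
            Run (f s) (concatMap g (iterate suc s n)) (f (s + n))
Run-chain f g s zero    []         = subst (λ e → Run (f s) [] (f e)) (sym (+-identityʳ s)) []
Run-chain f g s (suc n) (st ∷ sts) =
  Run-++ st (subst (λ e → Run (f (suc s)) (concatMap g (iterate suc (suc s) n)) (f e)) (sym (+-suc s n))
                   (Run-chain f g (suc s) n sts))

-- The word i_k

tfs fts : ℕ → List Bool
tfs zero    = []
tfs (suc m) = true ∷ false ∷ tfs m
fts zero    = []
fts (suc m) = false ∷ true ∷ fts m

stride : ℕ → ℕ → List ℕ
stride p zero    = []
stride p (suc m) = suc p ∷ stride (2 + p) m

applyUpTo-stride : ∀ (f : ℕ → ℕ) p m → (∀ j → f j ≡ p + 1 + 2 * j) → applyUpTo f m ≡ stride p m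
applyUpTo-stride f p zero    _  = refl
applyUpTo-stride f p (suc m) hf =
  cong₂ _∷_ (trans (hf 0) (first p))
            (applyUpTo-stride (λ j → f (suc j)) (2 + p) m (λ j → trans (hf (suc j)) (next p j)))
  where
  first : ∀ p → p + 1 + 2 * 0 ≡ suc p
  first = solve-∀
  next : ∀ p j → p + 1 + 2 * suc j ≡ 2 + p + 1 + 2 * j
  next = solve-∀

Run-row : ∀ X m Y → Run (X ++ tfs m ++ Y) (stride (length X) m) (X ++ fts m ++ Y)
Run-row X zero    Y = []
Run-row X (suc m) Y =
  TrueFalseAt-++ X (tfs m ++ Y) ∷
  Run-cast from letters to (Run-row (X ++ false ∷ true ∷ []) m Y)
  where
  from : (X ++ false ∷ true ∷ []) ++ tfs m ++ Y ≡ swapAtᵇ (suc (length X)) (X ++ true ∷ false ∷ tfs m ++ Y)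
  from = trans (++-assoc X _ _) (sym (swapAtᵇ-++ X true false (tfs m ++ Y)))
  letters : stride (length (X ++ false ∷ true ∷ [])) m ≡ stride (2 + length X) m
  letters = cong (λ p → stride p m) (trans (length-++ X) (+-comm (length X) 2))
  to : (X ++ false ∷ true ∷ []) ++ fts m ++ Y ≡ X ++ fts (suc m) ++ Y
  to = ++-assoc X _ _

framed : Bool → ℕ → ℕ → List Bool
framed x d m = replicate d x ++ tfs m ++ replicate d (not x)

true∷fts : ∀ m Z → true ∷ fts m ++ Z ≡ tfs m ++ true ∷ Z
true∷fts zero    Z = refl
true∷fts (suc m) Z = cong (λ W → true ∷ false ∷ W) (true∷fts m Z)

true∷fts∷false : ∀ m Z → true ∷ fts m ++ false ∷ Z ≡ tfs (suc m) ++ Z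
true∷fts∷false zero    Z = refl
true∷fts∷false (suc m) Z = cong (λ W → true ∷ false ∷ W) (true∷fts∷false m Z)

Run-framed : ∀ x d m → Run (framed x d m) (stride d m) (replicate d x ++ fts m ++ replicate d (not x))
Run-framed x d m =
  subst (λ p → Run (framed x d m) (stride p m) (replicate d x ++ fts m ++ replicate d (not x)))
        (length-replicate d) (Run-row (replicate d x) m (replicate d (not x)))

Run-framed-up : ∀ d m → Run (framed true (suc d) m) (stride (suc d) m) (framed true d (suc m))
Run-framed-up d m = subst (Run _ _) rearrange (Run-framed true (suc d) m)
  where
  rearrange : replicate (suc d) true ++ fts m ++ replicate (suc d) false ≡ framed true d (suc m)
  rearrange = trans (sym (replicate-++-∷ d true _))
                (cong (replicate d true ++_) (true∷fts∷false m (replicate d false)))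

Run-framed-turn : ∀ m → Run (framed true 0 (suc m)) (stride 0 (suc m)) (framed false 1 m)
Run-framed-turn m = subst (Run _ _) (cong (false ∷_) (true∷fts m [])) (Run-framed true 0 (suc m))

Run-framed-down : ∀ t m → Run (framed false t (suc m)) (stride t (suc m)) (framed false (suc t) m)
Run-framed-down t m = subst (Run _ _) rearrange (Run-framed false t (suc m))
  where
  rearrange : replicate t false ++ fts (suc m) ++ replicate t true ≡ framed false (suc t) m
  rearrange = trans (cong (replicate t false ++_) (cong (false ∷_) (true∷fts m (replicate t true))))
                (replicate-++-∷ t false _)

-- the bit string reached after the rows R₁ … R_{r−1}
state : ℕ → ℕ → List Bool
state k r with r ≤ᵇ k
... | true  = framed true (k ∸ r) r
... | false = framed false (r ∸ k) (2 * k ∸ r)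

2*k∸[k+t] : ∀ k t → 2 * k ∸ (k + t) ≡ k ∸ t
2*k∸[k+t] k t = trans ([m+n]∸[m+o]≡n∸o k (k + 0) t) (cong (_∸ t) (+-identityʳ k))

state-low : ∀ r d → state (r + d) r ≡ framed true d r
state-low r d rewrite ≤ᵇ≡true (m≤m+n r d) = cong (λ e → framed true e r) (m+n∸m≡n r d)

state-high : ∀ k t → 1 ≤ t → state k (k + t) ≡ framed false t (k ∸ t)
state-high k t 1≤t rewrite ≤ᵇ≡false (m<m+n k 1≤t) = cong₂ (framed false) (m+n∸m≡n k t) (2*k∸[k+t] k t)

rowUp-stride : ∀ k r → rowUp k r ≡ stride (k ∸ r) r
rowUp-stride k r = trans (map-upTo _ r) (applyUpTo-stride _ (k ∸ r) r (λ _ → refl))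

row-low : ∀ r d → row (r + d) r ≡ stride d r
row-low r d rewrite ≤ᵇ≡true (m≤m+n r d) = trans (rowUp-stride (r + d) r) (cong (λ e → stride e r) (m+n∸m≡n r d))

row-high : ∀ k t → 1 ≤ t → t ≤ k → row k (k + t) ≡ stride t (k ∸ t)
row-high k t 1≤t t≤k rewrite ≤ᵇ≡false (m<m+n k 1≤t) = begin
  rowUp k (2 * k ∸ (k + t))   ≡⟨ cong (rowUp k) (2*k∸[k+t] k t) ⟩
  rowUp k (k ∸ t)             ≡⟨ rowUp-stride k (k ∸ t) ⟩
  stride (k ∸ (k ∸ t)) (k ∸ t) ≡⟨ cong (λ e → stride e (k ∸ t)) (m∸[m∸n]≡n t≤k) ⟩
  stride t (k ∸ t)            ∎
  where open ≡-Reasoning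

RowStep : ℕ → ℕ → Set
RowStep k r = Run (state k r) (row k r) (state k (suc r))

rowStep-low : ∀ r d → RowStep (r + suc d) r
rowStep-low r d = Run-cast (sym (state-low r (suc d))) (sym (row-low r (suc d))) to (Run-framed-up d r)
  where
  to : framed true d (suc r) ≡ state (r + suc d) (suc r)
  to = trans (sym (state-low (suc r) d)) (cong (λ k → state k (suc r)) (sym (+-suc r d)))

rowStep-middle : ∀ m → RowStep (suc m) (suc m)
rowStep-middle m = Run-cast from letters to (Run-framed-turn m)
  where
  k : ℕ
  k = suc m
  from : framed true 0 k ≡ state k k
  from = trans (sym (state-low k 0)) (cong (λ k′ → state k′ k) (+-identityʳ k))
  letters : stride 0 k ≡ row k k
  letters = trans (sym (row-low k 0)) (cong (λ k′ → row k′ k) (+-identityʳ k))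
  to : framed false 1 m ≡ state k (suc k)
  to = trans (sym (state-high k 1 (s≤s z≤n))) (cong (state k) (+-comm k 1))

rowStep-high : ∀ t m → RowStep (suc t + suc m) (suc t + suc m + suc t)
rowStep-high t m = Run-cast from letters to (Run-framed-down (suc t) m)
  where
  k : ℕ
  k = suc t + suc m
  k∸[1+t] : k ∸ suc t ≡ suc m
  k∸[1+t] = m+n∸m≡n (suc t) (suc m)
  k∸[2+t] : k ∸ suc (suc t) ≡ m
  k∸[2+t] = trans (cong (_∸ suc t) (+-suc t m)) (m+n∸m≡n t m)
  from : framed false (suc t) (suc m) ≡ state k (k + suc t)
  from = sym (trans (state-high k (suc t) (s≤s z≤n)) (cong (framed false (suc t)) k∸[1+t]))
  letters : stride (suc t) (suc m) ≡ row k (k + suc t)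
  letters = sym (trans (row-high k (suc t) (s≤s z≤n) (m≤m+n (suc t) (suc m))) (cong (stride (suc t)) k∸[1+t]))
  to : framed false (suc (suc t)) m ≡ state k (suc (k + suc t))
  to = sym (begin
    state k (suc (k + suc t))               ≡⟨ cong (state k) (sym (+-suc k (suc t))) ⟩
    state k (k + suc (suc t))               ≡⟨ state-high k (suc (suc t)) (s≤s z≤n) ⟩
    framed false (suc (suc t)) (k ∸ suc (suc t)) ≡⟨ cong (framed false (suc (suc t))) k∸[2+t] ⟩
    framed false (suc (suc t)) m            ∎)
    where open ≡-Reasoning

rowStep : ∀ k r → 1 ≤ r → r < 2 * k → RowStep k r
rowStep k r 1≤r r<2k with <-cmp r k
... | tri< r<k _ _ with <-split r<k
...   | d , refl = rowStep-low r d
rowStep k (suc m) _ _ | tri≈ _ refl _ = rowStep-middle m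
rowStep k r 1≤r r<2k | tri> _ _ k<r with <-split k<r
... | t , refl with <-split (k+t≤2k⇒t≤k k (suc (suc t)) (subst (_≤ 2 * k) (sym (+-suc k (suc t))) r<2k))
...   | m , refl = rowStep-high t m

base final : ℕ → List Bool
base  k = replicate k true  ++ replicate k false
final k = replicate k false ++ replicate k true

Run-word : ∀ k → 1 ≤ k → Run (base k) (wordI k) (final k)
Run-word k@(suc k′) (s≤s z≤n) =
  Run-cast from (cong (concatMap (row k)) (sym (map-suc-upTo (2 * k ∸ 1)))) to
    (Run-chain (state k) (row k) 1 (2 * k ∸ 1)
      (All-iterate-suc 1 (2 * k ∸ 1) (λ r 1≤r r<1+n → rowStep k r 1≤r (subst (r <_) 1+[2k∸1] r<1+n))))
  where
  1+[2k∸1] : 1 + (2 * k ∸ 1) ≡ 2 * k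
  1+[2k∸1] = m+[n∸m]≡n (s≤s z≤n)
  from : state k 1 ≡ base k
  from = trans (state-low 1 k′) (replicate-++-∷ k′ true (false ∷ replicate k′ false))
  to : state k (1 + (2 * k ∸ 1)) ≡ final k
  to = begin
    state k (1 + (2 * k ∸ 1))   ≡⟨ cong (state k) (trans 1+[2k∸1] (cong (k +_) (+-identityʳ k))) ⟩
    state k (k + k)             ≡⟨ state-high k k (s≤s z≤n) ⟩
    framed false k (k ∸ k)      ≡⟨ cong (framed false k) (n∸n≡0 k) ⟩
    final k                     ∎
    where open ≡-Reasoning

-- Prefixes of the commutation class

data Balanced : ℕ → ℕ → List Bool → Set where
  []      : Balanced 0 0 []
  true∷_  : ∀ {a c b} → Balanced a c b → Balanced (suc a) c (true ∷ b)
  false∷_ : ∀ {a c b} → Balanced a c b → Balanced a (suc c) (false ∷ b)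

Balanced-sorted : ∀ a c → Balanced a c (replicate a true ++ replicate c false)
Balanced-sorted (suc a) c       = true∷ (Balanced-sorted a c)
Balanced-sorted zero    (suc c) = false∷ (Balanced-sorted zero c)
Balanced-sorted zero    zero    = []

Balanced-blocks : ∀ p q r → Balanced (p + r) q (replicate p true ++ replicate q false ++ replicate r true)
Balanced-blocks (suc p) q       r       = true∷ (Balanced-blocks p q r)
Balanced-blocks zero    (suc q) r       = false∷ (Balanced-blocks zero q r)
Balanced-blocks zero    zero    (suc r) = true∷ (Balanced-blocks zero zero r)
Balanced-blocks zero    zero    zero    = []

Balanced-not : ∀ {a c b} → Balanced a c b → Balanced c a (map not b)
Balanced-not []           = []
Balanced-not (true∷ bal)  = false∷ (Balanced-not bal)
Balanced-not (false∷ bal) = true∷ (Balanced-not bal)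

Balanced-swapAtᵇ : ∀ i {a e c} → TrueFalseAt i c → Balanced a e c → Balanced a e (swapAtᵇ i c)
Balanced-swapAtᵇ (suc zero)    t (true∷ (false∷ bal)) = false∷ (true∷ bal)
Balanced-swapAtᵇ (suc (suc i)) t (true∷ bal)          = true∷ (Balanced-swapAtᵇ (suc i) t bal)
Balanced-swapAtᵇ (suc (suc i)) t (false∷ bal)         = false∷ (Balanced-swapAtᵇ (suc i) t bal)

Balanced-Run : ∀ {c u d a e} → Run c u d → Balanced a e c → Balanced a e d
Balanced-Run []            bal = bal
Balanced-Run (_∷_ {i} t r) bal = Balanced-Run r (Balanced-swapAtᵇ i t bal)

Run-false-to-front : ∀ a Z → ∃[ u ] Run (replicate a true ++ false ∷ Z) u (false ∷ replicate a true ++ Z)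
Run-false-to-front zero    Z = [] , []
Run-false-to-front (suc a) Z with Run-false-to-front a Z
... | u , r = map suc u ++ [ 1 ] , Run-++ (Run-∷ true r) (tt ∷ [])

Balanced-Run-from-sorted : ∀ {a c b} → Balanced a c b → ∃[ u ] Run (replicate a true ++ replicate c false) u b
Balanced-Run-from-sorted []          = [] , []
Balanced-Run-from-sorted (true∷ bal) with Balanced-Run-from-sorted bal
... | u , r = map suc u , Run-∷ true r
Balanced-Run-from-sorted {a} {suc c} (false∷ bal)
  with Run-false-to-front a (replicate c false) | Balanced-Run-from-sorted bal
... | u₁ , r₁ | u₂ , r₂ = u₁ ++ map suc u₂ , Run-++ r₁ (Run-∷ false r₂)

NoTrueFalse : List Bool → Set
NoTrueFalse d = ∀ i → ¬ TrueFalseAt i d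

noTrueFalse-trues : ∀ b → NoTrueFalse (replicate b true)
noTrueFalse-trues zero          (suc zero)    ()
noTrueFalse-trues zero          (suc (suc i)) ()
noTrueFalse-trues (suc zero)    (suc zero)    ()
noTrueFalse-trues (suc (suc b)) (suc zero)    ()
noTrueFalse-trues (suc b)       (suc (suc i)) t = noTrueFalse-trues b (suc i) t

noTrueFalse-final : ∀ a b → NoTrueFalse (replicate a false ++ replicate b true)
noTrueFalse-final zero    b i             t = noTrueFalse-trues b i t
noTrueFalse-final (suc a) b (suc zero)    ()
noTrueFalse-final (suc a) b (suc (suc i)) t = noTrueFalse-final a b (suc i) t

≡⊎adjacent⊎Far : ∀ x j → x ≡ j ⊎ suc x ≡ j ⊎ suc j ≡ x ⊎ Far x j
≡⊎adjacent⊎Far zero          zero          = inj₁ refl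
≡⊎adjacent⊎Far zero          (suc zero)    = inj₂ (inj₁ refl)
≡⊎adjacent⊎Far zero          (suc (suc j)) = inj₂ (inj₂ (inj₂ (inj₁ (s≤s (s≤s z≤n)))))
≡⊎adjacent⊎Far (suc zero)    zero          = inj₂ (inj₂ (inj₁ refl))
≡⊎adjacent⊎Far (suc (suc x)) zero          = inj₂ (inj₂ (inj₂ (inj₂ (s≤s (s≤s z≤n)))))
≡⊎adjacent⊎Far (suc x)       (suc j)       =
  Sum.map (cong suc) (Sum.map (cong suc) (Sum.map (cong suc) (Sum.map s≤s s≤s))) (≡⊎adjacent⊎Far x j)

-- A pair true, false at j survives every letter at distance ≥ 2 and blocks the letters at distance 1;
-- as it is gone in d, the letter j must occur, preceded only by letters far from j.
Run-first-occurrence : ∀ {c s d j} → Run c s d → NoTrueFalse d → TrueFalseAt j c →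
                       ∃[ v ] ∃[ r ] (s ≡ v ++ j ∷ r × All (Far j) v)
Run-first-occurrence {j = j} [] noTF t = ⊥-elim (noTF j t)
Run-first-occurrence {c} {x ∷ s} {j = j} (tx ∷ run) noTF t with ≡⊎adjacent⊎Far x j
... | inj₁ refl                 = [] , s , refl , []
... | inj₂ (inj₁ refl)          = ⊥-elim (TrueFalseAt-adjacent x c tx t)
... | inj₂ (inj₂ (inj₁ refl))   = ⊥-elim (TrueFalseAt-adjacent j c t tx)
... | inj₂ (inj₂ (inj₂ far)) with Run-first-occurrence {j = j} run noTF (TrueFalseAt-swapAtᵇ⁺ c far t)
...   | v , r , refl , far-v = x ∷ v , r , refl , Far-sym far ∷ far-v

commute-to-front : ∀ p v j r → All (Far j) v → InCommClass (p ++ v ++ j ∷ r) (p ++ j ∷ v ++ r)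
commute-to-front p []      j r []           = ε
commute-to-front p (x ∷ v) j r (far ∷ fars) =
  subst₂ InCommClass (++-assoc p [ x ] _) (++-assoc p [ x ] _) (commute-to-front (p ++ [ x ]) v j r fars)
  ◅◅ (comm p (v ++ r) x j (Far-sym far) ◅ ε)

Reachable : ℕ → List Bool → Set
Reachable k b = ∃[ p ] ∃[ s ] (InCommClass (wordI k) (p ++ s) × Run (base k) p b)

Reachable-swapAtᵇ : ∀ {k b j} → 1 ≤ k → Reachable k b → TrueFalseAt j b → Reachable k (swapAtᵇ j b)
Reachable-swapAtᵇ {k} {b} {j} 1≤k (p , s , cls , run) t
  with Run-++⁻ p (Run-commClass cls (Run-word k 1≤k))
... | _ , run₁ , run₂ with Run-functional run₁ run
... | refl with Run-first-occurrence {j = j} run₂ (noTrueFalse-final k k) t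
... | v , r , refl , far-v =
  p ++ [ j ] , v ++ r ,
  cls ◅◅ subst (InCommClass _) (sym (++-assoc p [ j ] (v ++ r))) (commute-to-front p v j r far-v) ,
  Run-++ run (t ∷ [])

Reachable-Run : ∀ {k c u d} → 1 ≤ k → Reachable k c → Run c u d → Reachable k d
Reachable-Run 1≤k reach []      = reach
Reachable-Run 1≤k reach (t ∷ r) = Reachable-Run 1≤k (Reachable-swapAtᵇ 1≤k reach t) r

-- Interleavings and shuffles

interleave : List ℕ → List ℕ → List Bool → List ℕ
interleave xs ys []          = []
interleave xs ys (true  ∷ b) with xs
... | []      = []
... | x ∷ xs′ = x ∷ interleave xs′ ys b
interleave xs ys (false ∷ b) with ys
... | []      = []
... | y ∷ ys′ = y ∷ interleave xs ys′ b

interleave-swapAtᵇ : ∀ i c xs ys → TrueFalseAt i c → Balanced (length xs) (length ys) c →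
                     swapAt i (interleave xs ys c) ≡ interleave xs ys (swapAtᵇ i c)
interleave-swapAtᵇ (suc zero)    (true ∷ false ∷ c) (x ∷ xs) (y ∷ ys) t (true∷ (false∷ bal)) = refl
interleave-swapAtᵇ (suc (suc i)) (true ∷ c)  (x ∷ xs) ys t (true∷ bal)  =
  cong (x ∷_) (interleave-swapAtᵇ (suc i) c xs ys t bal)
interleave-swapAtᵇ (suc (suc i)) (false ∷ c) xs (y ∷ ys) t (false∷ bal) =
  cong (y ∷_) (interleave-swapAtᵇ (suc i) c xs ys t bal)

foldl-swapAt-interleave : ∀ {c u d} xs ys → Run c u d → Balanced (length xs) (length ys) c →
                          foldl (λ w i → swapAt i w) (interleave xs ys c) u ≡ interleave xs ys d
foldl-swapAt-interleave xs ys []                    _   = refl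
foldl-swapAt-interleave xs ys (_∷_ {i} {c} {u} t r) bal =
  trans (cong (λ w → foldl (λ w i → swapAt i w) w u) (interleave-swapAtᵇ i c xs ys t bal))
        (foldl-swapAt-interleave xs ys r (Balanced-swapAtᵇ i t bal))

interleave-sorted : ∀ xs ys →
                    interleave xs ys (replicate (length xs) true ++ replicate (length ys) false) ≡ xs ++ ys
interleave-sorted (x ∷ xs) ys       = cong (x ∷_) (interleave-sorted xs ys)
interleave-sorted []       []       = refl
interleave-sorted []       (y ∷ ys) = cong (y ∷_) (interleave-sorted [] ys)

interleave-↭ : ∀ xs ys b → Balanced (length xs) (length ys) b → interleave xs ys b ↭ xs ++ ys
interleave-↭ []       []       []          []           = ↭-refl
interleave-↭ (x ∷ xs) ys       (true ∷ b)  (true∷ bal)  = prep x (interleave-↭ xs ys b bal)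
interleave-↭ xs       (y ∷ ys) (false ∷ b) (false∷ bal) =
  ↭-trans (prep y (interleave-↭ xs ys b bal)) (↭-sym (shift y xs ys))

map-interleave : ∀ (f : ℕ → ℕ) xs ys b →
                 map f (interleave xs ys b) ≡ interleave (map f ys) (map f xs) (map not b)
map-interleave f (x ∷ xs) ys       (true  ∷ b) = cong (f x ∷_) (map-interleave f xs ys b)
map-interleave f []       ys       (true  ∷ b) = refl
map-interleave f xs       (y ∷ ys) (false ∷ b) = cong (f y ∷_) (map-interleave f xs ys b)
map-interleave f xs       []       (false ∷ b) = refl
map-interleave f xs       ys       []          = refl

∈-interleaveˡ : ∀ xs ys b {z} → Balanced (length xs) (length ys) b → z ∈ xs → z ∈ interleave xs ys b
∈-interleaveˡ (x ∷ xs) ys       (true ∷ b)  (true∷ bal)  (here refl) = here refl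
∈-interleaveˡ (x ∷ xs) ys       (true ∷ b)  (true∷ bal)  (there z∈)  = there (∈-interleaveˡ xs ys b bal z∈)
∈-interleaveˡ xs       (y ∷ ys) (false ∷ b) (false∷ bal) z∈          = there (∈-interleaveˡ xs ys b bal z∈)

∈-interleaveʳ : ∀ xs ys b {z} → Balanced (length xs) (length ys) b → z ∈ ys → z ∈ interleave xs ys b
∈-interleaveʳ xs       (y ∷ ys) (false ∷ b) (false∷ bal) (here refl) = here refl
∈-interleaveʳ xs       (y ∷ ys) (false ∷ b) (false∷ bal) (there z∈)  = there (∈-interleaveʳ xs ys b bal z∈)
∈-interleaveʳ (x ∷ xs) ys       (true ∷ b)  (true∷ bal)  z∈          = there (∈-interleaveʳ xs ys b bal z∈)

Before-interleaveˡ : ∀ xs ys b {u v} → Balanced (length xs) (length ys) b → Before xs u v →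
                     Before (interleave xs ys b) u v
Before-interleaveˡ []       ys       b           _            bf = ⊥-elim (¬Before-[] bf)
Before-interleaveˡ (x ∷ xs) ys       (true ∷ b)  (true∷ bal)  bf with Before-∷⁻ bf
... | inj₁ (refl , v∈xs) = Before-here (∈-interleaveˡ xs ys b bal v∈xs)
... | inj₂ bf′           = Before-∷ (Before-interleaveˡ xs ys b bal bf′)
Before-interleaveˡ (x ∷ xs) (y ∷ ys) (false ∷ b) (false∷ bal) bf =
  Before-∷ (Before-interleaveˡ (x ∷ xs) ys b bal bf)

Before-interleaveʳ : ∀ xs ys b {u v} → Balanced (length xs) (length ys) b → Before ys u v →
                     Before (interleave xs ys b) u v
Before-interleaveʳ xs       []       b           _            bf = ⊥-elim (¬Before-[] bf)
Before-interleaveʳ xs       (y ∷ ys) (false ∷ b) (false∷ bal) bf with Before-∷⁻ bf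
... | inj₁ (refl , v∈ys) = Before-here (∈-interleaveʳ xs ys b bal v∈ys)
... | inj₂ bf′           = Before-∷ (Before-interleaveʳ xs ys b bal bf′)
Before-interleaveʳ (x ∷ xs) (y ∷ ys) (true ∷ b)  (true∷ bal)  bf =
  Before-∷ (Before-interleaveʳ xs (y ∷ ys) b bal bf)

interleavings : List ℕ → List ℕ → List (List ℕ)
interleavings []       []       = [ [] ]
interleavings (x ∷ xs) []       = map (x ∷_) (interleavings xs [])
interleavings []       (y ∷ ys) = map (y ∷_) (interleavings [] ys)
interleavings (x ∷ xs) (y ∷ ys) =
  map (x ∷_) (interleavings xs (y ∷ ys)) ++ map (y ∷_) (interleavings (x ∷ xs) ys)

∈-interleavings : ∀ xs ys b → Balanced (length xs) (length ys) b → interleave xs ys b ∈ interleavings xs ys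
∈-interleavings []       []       []          []           = here refl
∈-interleavings (x ∷ xs) []       (true ∷ b)  (true∷ bal)  = ∈-map⁺ (x ∷_) (∈-interleavings xs [] b bal)
∈-interleavings (x ∷ xs) (y ∷ ys) (true ∷ b)  (true∷ bal)  =
  ∈-++⁺ˡ (∈-map⁺ (x ∷_) (∈-interleavings xs (y ∷ ys) b bal))
∈-interleavings []       (y ∷ ys) (false ∷ b) (false∷ bal) = ∈-map⁺ (y ∷_) (∈-interleavings [] ys b bal)
∈-interleavings (x ∷ xs) (y ∷ ys) (false ∷ b) (false∷ bal) =
  ∈-++⁺ʳ (map (x ∷_) (interleavings xs (y ∷ ys))) (∈-map⁺ (y ∷_) (∈-interleavings (x ∷ xs) ys b bal))

InterleavingOf : List ℕ → List ℕ → List ℕ → Set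
InterleavingOf xs ys w = ∃[ b ] (Balanced (length xs) (length ys) b × w ≡ interleave xs ys b)

InterleavingOf-left : ∀ x xs ys {w} → (∀ {w′} → w′ ∈ interleavings xs ys → InterleavingOf xs ys w′) →
                      w ∈ map (x ∷_) (interleavings xs ys) → InterleavingOf (x ∷ xs) ys w
InterleavingOf-left x xs ys sound w∈ with ∈-map⁻ (x ∷_) w∈
... | _ , w′∈ , refl with sound w′∈
... | b , bal , refl = true ∷ b , true∷ bal , refl

InterleavingOf-right : ∀ xs y ys {w} → (∀ {w′} → w′ ∈ interleavings xs ys → InterleavingOf xs ys w′) →
                       w ∈ map (y ∷_) (interleavings xs ys) → InterleavingOf xs (y ∷ ys) w
InterleavingOf-right xs y ys sound w∈ with ∈-map⁻ (y ∷_) w∈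
... | _ , w′∈ , refl with sound w′∈
... | b , bal , refl = false ∷ b , false∷ bal , refl

interleavings-sound : ∀ xs ys {w} → w ∈ interleavings xs ys → InterleavingOf xs ys w
interleavings-sound []       []       (here refl) = [] , [] , refl
interleavings-sound (x ∷ xs) []       w∈ = InterleavingOf-left x xs [] (interleavings-sound xs []) w∈
interleavings-sound []       (y ∷ ys) w∈ = InterleavingOf-right [] y ys (interleavings-sound [] ys) w∈
interleavings-sound (x ∷ xs) (y ∷ ys) w∈ =
  Sum.[ InterleavingOf-left x xs (y ∷ ys) (interleavings-sound xs (y ∷ ys)) ,
        InterleavingOf-right (x ∷ xs) y ys (interleavings-sound (x ∷ xs) ys) ]
      (∈-++⁻ (map (x ∷_) (interleavings xs (y ∷ ys))) w∈)

interleavings-unique : ∀ xs ys → Disjoint xs ys → Unique (interleavings xs ys)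
interleavings-unique []       []       _ = [] ∷ []
interleavings-unique (x ∷ xs) []       _ = Unique.map⁺ ∷-injectiveʳ (interleavings-unique xs [] λ { (_ , ()) })
interleavings-unique []       (y ∷ ys) _ = Unique.map⁺ ∷-injectiveʳ (interleavings-unique [] ys λ { (() , _) })
interleavings-unique (x ∷ xs) (y ∷ ys) disjoint =
  Unique.++⁺
    (Unique.map⁺ ∷-injectiveʳ (interleavings-unique xs (y ∷ ys) λ (v∈xs , v∈ys) → disjoint (there v∈xs , v∈ys)))
    (Unique.map⁺ ∷-injectiveʳ (interleavings-unique (x ∷ xs) ys λ (v∈xs , v∈ys) → disjoint (v∈xs , there v∈ys)))
    heads-differ
  where
  heads-differ : Disjoint (map (x ∷_) (interleavings xs (y ∷ ys))) (map (y ∷_) (interleavings (x ∷ xs) ys))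
  heads-differ (w∈ˡ , w∈ʳ) with ∈-map⁻ (x ∷_) w∈ˡ | ∈-map⁻ (y ∷_) w∈ʳ
  ... | _ , _ , refl | _ , _ , eq = disjoint (here refl , here (∷-injectiveˡ eq))

blockElem : ℕ → Bool → ℕ → ℕ
blockElem k true  i = i
blockElem k false i = k + i

half : ℕ → Bool → List ℕ
half k h = map (blockElem k h) (iterate suc 1 k)

shuffle : ℕ → List Bool → List ℕ
shuffle k = interleave (half k true) (half k false)

length-half : ∀ k h → length (half k h) ≡ k
length-half k h = trans (length-map (blockElem k h) (iterate suc 1 k)) (length-iterate suc 1 k)

Balanced-half : ∀ {k b} → Balanced k k b → Balanced (length (half k true)) (length (half k false)) b
Balanced-half {k} = subst₂ (λ a c → Balanced a c _) (sym (length-half k true)) (sym (length-half k false))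

half-true : ∀ k → half k true ≡ iterate suc 1 k
half-true k = map-id (iterate suc 1 k)

half-false : ∀ k → half k false ≡ iterate suc (suc k) k
half-false k = trans (map-+-iterate-suc k 1 k) (cong (λ e → iterate suc e k) (+-comm k 1))

halves-++ : ∀ k → half k true ++ half k false ≡ idPerm (2 * k)
halves-++ k = begin
  half k true ++ half k false           ≡⟨ cong₂ _++_ (half-true k) (half-false k) ⟩
  iterate suc 1 k ++ iterate suc (suc k) k ≡⟨ sym (iterate-suc-++ 1 k k) ⟩
  iterate suc 1 (k + k)                 ≡⟨ cong (iterate suc 1) (cong (k +_) (sym (+-identityʳ k))) ⟩
  iterate suc 1 (2 * k)                 ≡⟨ sym (map-suc-upTo (2 * k)) ⟩
  idPerm (2 * k)                        ∎
  where open ≡-Reasoning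

shuffle-base : ∀ k → shuffle k (base k) ≡ idPerm (2 * k)
shuffle-base k =
  trans (cong (shuffle k) sorted-lengths) (trans (interleave-sorted (half k true) (half k false)) (halves-++ k))
  where
  sorted-lengths : base k ≡ replicate (length (half k true)) true ++ replicate (length (half k false)) false
  sorted-lengths = sym (cong₂ (λ a c → replicate a true ++ replicate c false) (length-half k true) (length-half k false))

evalWord-shuffle : ∀ {k u b} → Run (base k) u b → evalWord (2 * k) u ≡ shuffle k b
evalWord-shuffle {k} {u} r =
  trans (cong (λ w → foldl (λ w i → swapAt i w) w u) (sym (shuffle-base k)))
        (foldl-swapAt-interleave (half k true) (half k false) r (Balanced-half (Balanced-sorted k k)))

IsShuffle : ℕ → List ℕ → Set
IsShuffle k w = ∃[ b ] (Balanced k k b × w ≡ shuffle k b)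

InPre⇒IsShuffle : ∀ {k w} → 1 ≤ k → InPre (2 * k) (wordI k) w → IsShuffle k w
InPre⇒IsShuffle {k} 1≤k (u , m , cls , refl)
  with Run-++⁻ (take m u) (subst (λ v → Run (base k) v (final k)) (sym (take++drop≡id m u))
                                 (Run-commClass cls (Run-word k 1≤k)))
... | b , r , _ = b , Balanced-Run r (Balanced-sorted k k) , evalWord-shuffle r

IsShuffle⇒InPre : ∀ {k w} → 1 ≤ k → IsShuffle k w → InPre (2 * k) (wordI k) w
IsShuffle⇒InPre {k} 1≤k (b , bal , refl) with Balanced-Run-from-sorted bal
... | u , r with Reachable-Run 1≤k ([] , wordI k , ε , []) r
... | p , s , cls , r′ =
  p ++ s , length p , cls , trans (sym (evalWord-shuffle r′)) (cong (evalWord (2 * k)) (sym (take-length-++ p s)))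

IsShuffle⇒IsPerm : ∀ {k w} → IsShuffle k w → IsPerm (2 * k) w
IsShuffle⇒IsPerm {k} (b , bal , refl) =
  ↭-trans (interleave-↭ (half k true) (half k false) b (Balanced-half bal)) (↭-reflexive (halves-++ k))

IsShuffle⇒Unique : ∀ {k w} → IsShuffle k w → Unique w
IsShuffle⇒Unique = IsPerm⇒Unique ∘ IsShuffle⇒IsPerm

∈-half : ∀ k h {i} → 1 ≤ i → i ≤ k → blockElem k h i ∈ half k h
∈-half k h 1≤i i≤k = ∈-map⁺ (blockElem k h) (∈-iterate-suc 1 k 1≤i (s≤s i≤k))

Before-half : ∀ k h {i j} → 1 ≤ i → i < j → j ≤ k → Before (half k h) (blockElem k h i) (blockElem k h j)
Before-half k h 1≤i i<j j≤k = Before-map (blockElem k h) (Before-iterate-suc 1 k 1≤i i<j (s≤s j≤k))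

Before-shuffle : ∀ {k w} h {i j} → IsShuffle k w → 1 ≤ i → i < j → j ≤ k →
                 Before w (blockElem k h i) (blockElem k h j)
Before-shuffle {k} true  (b , bal , refl) 1≤i i<j j≤k =
  Before-interleaveˡ (half k true) (half k false) b (Balanced-half bal) (Before-half k true 1≤i i<j j≤k)
Before-shuffle {k} false (b , bal , refl) 1≤i i<j j≤k =
  Before-interleaveʳ (half k true) (half k false) b (Balanced-half bal) (Before-half k false 1≤i i<j j≤k)

-- The majority relation

swapHalves : ℕ → ℕ → ℕ
swapHalves k x = if x ≤ᵇ k then k + x else x ∸ k

swapHalves-blockElem : ∀ k h {i} → 1 ≤ i → i ≤ k → swapHalves k (blockElem k h i) ≡ blockElem k (not h) i
swapHalves-blockElem k true  _   i≤k rewrite ≤ᵇ≡true i≤k          = refl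
swapHalves-blockElem k false 1≤i _   rewrite ≤ᵇ≡false (m<m+n k 1≤i) = m+n∸m≡n k _

mirror : ℕ → List ℕ → List ℕ
mirror k = map (swapHalves k)

mirror-half : ∀ k h → mirror k (half k h) ≡ half k (not h)
mirror-half k h =
  trans (sym (map-∘ (iterate suc 1 k)))
        (map-cong-local (All-iterate-suc 1 k λ i 1≤i i<1+k → swapHalves-blockElem k h 1≤i (≤-pred i<1+k)))

mirror-shuffle : ∀ k b → mirror k (shuffle k b) ≡ shuffle k (map not b)
mirror-shuffle k b =
  trans (map-interleave (swapHalves k) (half k true) (half k false) b)
        (cong₂ (λ xs ys → interleave xs ys (map not b)) (mirror-half k false) (mirror-half k true))

IsShuffle-mirror : ∀ {k w} → IsShuffle k w → IsShuffle k (mirror k w)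
IsShuffle-mirror {k} (b , bal , refl) = map not b , Balanced-not bal , mirror-shuffle k b

mirror-involutive : ∀ {k w} → IsShuffle k w → mirror k (mirror k w) ≡ w
mirror-involutive {k} (b , _ , refl) = begin
  mirror k (mirror k (shuffle k b)) ≡⟨ cong (mirror k) (mirror-shuffle k b) ⟩
  mirror k (shuffle k (map not b))  ≡⟨ mirror-shuffle k (map not b) ⟩
  shuffle k (map not (map not b))   ≡⟨ cong (shuffle k) (map-not-involutive b) ⟩
  shuffle k b                       ∎
  where open ≡-Reasoning

mirror-injective : ∀ {k w w′} → IsShuffle k w → IsShuffle k w′ → mirror k w ≡ mirror k w′ → w ≡ w′
mirror-injective {k} sw sw′ eq =
  trans (sym (mirror-involutive sw)) (trans (cong (mirror k) eq) (mirror-involutive sw′))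

Before-mirror : ∀ {k w} h h′ {i j} → 1 ≤ i → i ≤ k → 1 ≤ j → j ≤ k →
                Before w (blockElem k h i) (blockElem k h′ j) →
                Before (mirror k w) (blockElem k (not h) i) (blockElem k (not h′) j)
Before-mirror {k} h h′ 1≤i i≤k 1≤j j≤k b =
  subst₂ (Before _) (swapHalves-blockElem k h 1≤i i≤k) (swapHalves-blockElem k h′ 1≤j j≤k)
         (Before-map (swapHalves k) b)

interleave-blocks : ∀ P Y R →
  interleave (P ++ R) Y (replicate (length P) true ++ replicate (length Y) false ++ replicate (length R) true)
  ≡ P ++ Y ++ R
interleave-blocks (p ∷ P) Y       R       = cong (p ∷_) (interleave-blocks P Y R)
interleave-blocks []      (y ∷ Y) R       = cong (y ∷_) (interleave-blocks [] Y R)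
interleave-blocks []      []      (r ∷ R) = cong (r ∷_) (interleave-blocks [] [] R)
interleave-blocks []      []      []      = refl

witness : ℕ → ℕ → List Bool
witness k t = replicate t true ++ replicate k false ++ replicate (k ∸ t) true

witness-IsShuffle : ∀ {k t} → t ≤ k → IsShuffle k (shuffle k (witness k t))
witness-IsShuffle {k} {t} t≤k =
  witness k t , subst (λ a → Balanced a k (witness k t)) (m+[n∸m]≡n t≤k) (Balanced-blocks t k (k ∸ t)) , refl

shuffle-witness : ∀ {k t} → t ≤ k →
                  shuffle k (witness k t) ≡ iterate suc 1 t ++ half k false ++ iterate suc (suc t) (k ∸ t)
shuffle-witness {k} {t} t≤k = begin
  interleave (half k true) (half k false) (witness k t)
    ≡⟨ cong₂ (λ xs b → interleave xs (half k false) b) split-half blocks ⟩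
  interleave (P ++ R) (half k false)
             (replicate (length P) true ++ replicate (length (half k false)) false ++ replicate (length R) true)
    ≡⟨ interleave-blocks P (half k false) R ⟩
  P ++ half k false ++ R ∎
  where
  open ≡-Reasoning
  P R : List ℕ
  P = iterate suc 1 t
  R = iterate suc (suc t) (k ∸ t)
  split-half : half k true ≡ P ++ R
  split-half = trans (half-true k) (trans (cong (iterate suc 1) (sym (m+[n∸m]≡n t≤k))) (iterate-suc-++ 1 t (k ∸ t)))
  blocks : witness k t ≡ replicate (length P) true ++ replicate (length (half k false)) false
                                                    ++ replicate (length R) true
  blocks = sym (cong₂ (λ a W → replicate a true ++ W) (length-iterate suc 1 t)
                 (cong₂ (λ c r → replicate c false ++ replicate r true)
                        (length-half k false) (length-iterate suc (suc t) (k ∸ t))))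

Before-witness : ∀ {k i j} h h′ → 1 ≤ i → i < j → j ≤ k →
                 Before (shuffle k (witness k i)) (blockElem k h i) (blockElem k h′ j)
Before-witness {k} {i} {j} h h′ 1≤i i<j j≤k with h | h′ | <⇒≤ (<-≤-trans i<j j≤k)
... | true  | true  | i≤k = Before-shuffle true  (witness-IsShuffle i≤k) 1≤i i<j j≤k
... | false | false | i≤k = Before-shuffle false (witness-IsShuffle i≤k) 1≤i i<j j≤k
... | true  | false | i≤k =
  subst (λ w → Before w i (k + j)) (sym (shuffle-witness i≤k))
    (Before-++ (∈-iterate-suc 1 i 1≤i ≤-refl) (∈-++⁺ˡ (∈-half k false (≤-trans 1≤i (<⇒≤ i<j)) j≤k)))
... | false | true  | i≤k =
  subst (λ w → Before w (k + i) j) (sym (shuffle-witness i≤k))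
    (Before-++ʳ (iterate suc 1 i)
      (Before-++ (∈-half k false 1≤i i≤k) (∈-iterate-suc (suc i) (k ∸ i) i<j j<1+i+[k∸i])))
  where
  j<1+i+[k∸i] : j < suc i + (k ∸ i)
  j<1+i+[k∸i] = subst (j <_) (sym (cong suc (m+[n∸m]≡n i≤k))) (s≤s j≤k)

halves-disjoint : ∀ k → Disjoint (half k true) (half k false)
halves-disjoint k = Unique-++⇒Disjoint (half k true) (subst Unique (sym (halves-++ k)) (Unique-idPerm (2 * k)))

Voters : ℕ → ℕ → ℕ → List ℕ → Set
Voters k a c w = IsPerm (2 * k) w × InPre (2 * k) (wordI k) w × Before w a c

module _ {k : ℕ} (1≤k : 1 ≤ k) where

  Voters⇒IsShuffle : ∀ {a c w} → Voters k a c w → IsShuffle k w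
  Voters⇒IsShuffle (_ , pre , _) = InPre⇒IsShuffle 1≤k pre

  IsShuffle⇒Voters : ∀ {a c w} → IsShuffle k w → Before w a c → Voters k a c w
  IsShuffle⇒Voters sw b = IsShuffle⇒IsPerm sw , IsShuffle⇒InPre 1≤k sw , b

  Voters-hasCard : ∀ a c → ∃[ N ] HasCard (Voters k a c) N
  Voters-hasCard a c =
    _ , filter before? candidates ,
    Unique.filter⁺ before? (interleavings-unique (half k true) (half k false) (halves-disjoint k)) ,
    (λ w → mk⇔ sound complete) , refl
    where
    candidates : List (List ℕ)
    candidates = interleavings (half k true) (half k false)
    before? : ∀ w → Dec (Before w a c)
    before? w = Before? w a c
    sound : ∀ {w} → w ∈ filter before? candidates → Voters k a c w
    sound w∈ with ∈-filter⁻ before? w∈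
    ... | w∈′ , b with interleavings-sound (half k true) (half k false) w∈′
    ... | bits , bal , eq =
      IsShuffle⇒Voters (bits , subst₂ (λ a c → Balanced a c bits) (length-half k true) (length-half k false) bal , eq)
                       b
    complete : ∀ {w} → Voters k a c w → w ∈ filter before? candidates
    complete v@(_ , _ , b) with Voters⇒IsShuffle v
    ... | bits , bal , refl = ∈-filter⁺ before? (∈-interleavings _ _ bits (Balanced-half bal)) b

  HasCard-mirror : ∀ {a c N} → HasCard (Voters k a c) N → HasCard (Image (mirror k) (Voters k a c)) N
  HasCard-mirror hN =
    HasCard-image (mirror k) hN (λ v v′ → mirror-injective (Voters⇒IsShuffle v) (Voters⇒IsShuffle v′))

  Image-Voters : ∀ {a c a′ c′} → (∀ {w} → IsShuffle k w → Before w a c → Before (mirror k w) a′ c′) →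
                 ∀ {z} → Image (mirror k) (Voters k a c) z → Voters k a′ c′ z
  Image-Voters before-g (w , v@(_ , _ , b) , refl) =
    IsShuffle⇒Voters (IsShuffle-mirror (Voters⇒IsShuffle v)) (before-g (Voters⇒IsShuffle v) b)

  -- In the mirror image a precedes mirror c, which precedes mirror a, which precedes c.
  reversed-pair-swaps : ∀ h {i j w} → 1 ≤ i → i < j → j ≤ k → IsShuffle k w →
                        Before w (blockElem k (not h) j) (blockElem k h i) →
                        Before (mirror k w) (blockElem k h i) (blockElem k (not h) j)
  reversed-pair-swaps h {i} {j} {w} 1≤i i<j j≤k sw b =
    Before-trans u (Before-trans u (Before-shuffle h sgw 1≤i i<j j≤k) partners)
                   (Before-shuffle (not h) sgw 1≤i i<j j≤k)
    where
    sgw : IsShuffle k (mirror k w)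
    sgw = IsShuffle-mirror sw
    u : Unique (mirror k w)
    u = IsShuffle⇒Unique sgw
    1≤j : 1 ≤ j
    1≤j = ≤-trans 1≤i (<⇒≤ i<j)
    partners : Before (mirror k w) (blockElem k h j) (blockElem k (not h) i)
    partners = subst (λ h′ → Before (mirror k w) (blockElem k h′ j) (blockElem k (not h) i)) (not-involutive h)
                     (Before-mirror (not h) h 1≤j j≤k 1≤i (≤-trans (<⇒≤ i<j) j≤k) b)

  reversed-voter : ∀ h h′ {i j w} → 1 ≤ i → i < j → j ≤ k → IsShuffle k w →
                   Before w (blockElem k h′ j) (blockElem k h i) →
                   Before (mirror k w) (blockElem k h i) (blockElem k h′ j)
  reversed-voter true  false = reversed-pair-swaps true
  reversed-voter false true  = reversed-pair-swaps false
  reversed-voter true  true  1≤i i<j j≤k sw b =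
    ⊥-elim (Before-asym (IsShuffle⇒Unique sw) (Before-shuffle true  sw 1≤i i<j j≤k) b)
  reversed-voter false false 1≤i i<j j≤k sw b =
    ⊥-elim (Before-asym (IsShuffle⇒Unique sw) (Before-shuffle false sw 1≤i i<j j≤k) b)

  -- The witness ranks a before c and also mirror a before mirror c, so it is no mirror image of a
  -- shuffle ranking c before a.
  fewer-reversed : ∀ h h′ {i j N M} → 1 ≤ i → i < j → j ≤ k →
                   HasCard (Voters k (blockElem k h′ j) (blockElem k h i)) M →
                   HasCard (Voters k (blockElem k h i) (blockElem k h′ j)) N → M < N
  fewer-reversed h h′ {i} {j} 1≤i i<j j≤k hM hN =
    HasCard-⊂ (HasCard-mirror hM) hN (Image-Voters (reversed-voter h h′ 1≤i i<j j≤k))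
      w₀ (IsShuffle⇒Voters sw₀ (Before-witness h h′ 1≤i i<j j≤k)) w₀∉image
    where
    i≤k : i ≤ k
    i≤k = <⇒≤ (<-≤-trans i<j j≤k)
    w₀ : List ℕ
    w₀ = shuffle k (witness k i)
    sw₀ : IsShuffle k w₀
    sw₀ = witness-IsShuffle i≤k
    w₀∉image : ¬ Image (mirror k) (Voters k (blockElem k h′ j) (blockElem k h i)) w₀
    w₀∉image (w , (_ , _ , b) , eq) =
      Before-asym (IsShuffle⇒Unique sw₀) (Before-witness (not h) (not h′) 1≤i i<j j≤k)
        (subst (λ z → Before z _ _) (sym eq) (Before-mirror h′ h (≤-trans 1≤i (<⇒≤ i<j)) j≤k 1≤i i≤k b))

  partners-balanced : ∀ h {i N M} → 1 ≤ i → i ≤ k →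
                      HasCard (Voters k (blockElem k h i) (blockElem k (not h) i)) N →
                      HasCard (Voters k (blockElem k (not h) i) (blockElem k h i)) M → N ≤ M
  partners-balanced h {i} 1≤i i≤k hN hM = HasCard-⊆ (HasCard-mirror hN) hM (Image-Voters swapped)
    where
    swapped : ∀ {w} → IsShuffle k w → Before w (blockElem k h i) (blockElem k (not h) i) →
              Before (mirror k w) (blockElem k (not h) i) (blockElem k h i)
    swapped {w} _ b = subst (λ h′ → Before (mirror k w) (blockElem k (not h) i) (blockElem k h′ i)) (not-involutive h)
                            (Before-mirror h (not h) 1≤i i≤k 1≤i i≤k b)

  same-block : ∀ h h′ {i N M} → 1 ≤ i → i ≤ k →
               HasCard (Voters k (blockElem k h i) (blockElem k h′ i)) N →
               HasCard (Voters k (blockElem k h′ i) (blockElem k h i)) M → N ≤ M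
  same-block true  true  _ _ hN hM = HasCard-⊆ hN hM id
  same-block false false _ _ hN hM = HasCard-⊆ hN hM id
  same-block true  false = partners-balanced true
  same-block false true  = partners-balanced false

  majority⇔block< : ∀ h h′ {i j} → 1 ≤ i → i ≤ k → 1 ≤ j → j ≤ k →
                    UniformMajority (2 * k) (InPre (2 * k) (wordI k)) (blockElem k h i) (blockElem k h′ j) ⇔ i < j
  majority⇔block< h h′ {i} {j} 1≤i i≤k 1≤j j≤k = mk⇔ to from
    where
    to : UniformMajority (2 * k) (InPre (2 * k) (wordI k)) (blockElem k h i) (blockElem k h′ j) → i < j
    to (N , M , hN , hM , M<N) with <-cmp i j
    ... | tri< i<j _ _  = i<j
    ... | tri≈ _ refl _ = ⊥-elim (<⇒≱ M<N (same-block h h′ 1≤i i≤k hN hM))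
    ... | tri> _ _ j<i  = ⊥-elim (<-asym M<N (fewer-reversed h′ h 1≤j j<i i≤k hN hM))
    from : i < j → UniformMajority (2 * k) (InPre (2 * k) (wordI k)) (blockElem k h i) (blockElem k h′ j)
    from i<j
      with Voters-hasCard (blockElem k h i) (blockElem k h′ j) | Voters-hasCard (blockElem k h′ j) (blockElem k h i)
    ... | N , hN | M , hM = N , M , hN , hM , fewer-reversed h h′ 1≤i i<j j≤k hM hN

blockElem-surjective : ∀ k a → 1 ≤ a → a ≤ 2 * k → ∃[ h ] ∃[ i ] (1 ≤ i × i ≤ k × a ≡ blockElem k h i)
blockElem-surjective k a 1≤a a≤2k with ≤-<-connex a k
... | inj₁ a≤k = true , a , 1≤a , a≤k , refl
... | inj₂ k<a with <-split k<a
... | d , refl =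
  false , suc d , s≤s z≤n , k+t≤2k⇒t≤k k (suc d) a≤2k , refl

block-blockElem : ∀ k h {i} → 1 ≤ i → i ≤ k → block k (blockElem k h i) ≡ i
block-blockElem k true  _   i≤k rewrite ≤ᵇ≡true i≤k          = refl
block-blockElem k false 1≤i _   rewrite ≤ᵇ≡false (m<m+n k 1≤i) = m+n∸m≡n k _

proposition4p6 : (k : ℕ) → 1 ≤ k → (a b : ℕ) → 1 ≤ a → a ≤ 2 * k → 1 ≤ b → b ≤ 2 * k →
                 (UniformMajority (2 * k) (InPre (2 * k) (wordI k)) a b ⇔ PrelinOrder k a b)
proposition4p6 k 1≤k a b 1≤a a≤2k 1≤b b≤2k
  with blockElem-surjective k a 1≤a a≤2k | blockElem-surjective k b 1≤b b≤2k
... | h , i , 1≤i , i≤k , refl | h′ , j , 1≤j , j≤k , refl =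
  subst₂ (λ x y → UniformMajority (2 * k) (InPre (2 * k) (wordI k)) (blockElem k h i) (blockElem k h′ j) ⇔ x < y)
         (sym (block-blockElem k h 1≤i i≤k)) (sym (block-blockElem k h′ 1≤j j≤k))
         (majority⇔block< 1≤k h h′ 1≤i i≤k 1≤j j≤k)
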